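{- Let $S$ be a nonempty string whose run-length encoding has size $m$, and let $\mathcal{M}_S$ be the set of MUPSs of $S$. Then $|\mathcal{M}_S|\le m$.
   Context: The run-length encoding of $S$ is $\mathrm{RLE}_S=(a_1,e_1),\ldots,(a_m,e_m)$ with $a_j\in\Sigma$, $e_j$ positive integers, $a_j\neq a_{j+1}$, such that $S=a_1^{e_1}\cdots a_m^{e_m}$; $m$ is its size. $S[i..j]$ denotes the substring from position $i$ to $j$. $\mathrm{occ}_S(X)$ is the number of occurrences of $X$ in $S$. A substring $P=S[i..j]$ (counted as an occurrence, i.e. by its interval $[i,j]$) is a minimal unique palindromic substring (MUPS) of $S$ iff (1) $P$ is a palindrome with $\mathrm{occ}_S(P)=1$ and (2) either $1\le|P|\le 2$, or $|P|\ge 3$ and $\mathrm{occ}_S(S[i+1..j-1])\ge 2$. -}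

module Defs where

open import Data.Nat using (ℕ; zero; suc; _+_; _∸_; _≤_; _<_; _≥_)
open import Data.List using (List; []; _∷_; length; take; drop; reverse; upTo; filter)
open import Data.List.Relation.Binary.Prefix.Heterogeneous.Properties using (prefix?)
open import Data.List.Relation.Binary.Prefix.Heterogeneous using (Prefix)
open import Data.Product using (_×_; _,_; Σ)
open import Data.Sum using (_⊎_)
open import Relation.Binary.PropositionalEquality using (_≡_)
open import Relation.Binary.Definitions using (DecidableEquality)
open import Relation.Nullary.Decidable using (does)
open import Data.Bool using (Bool; true; false; if_then_else_)

module _ {A : Set} (_≟_ : DecidableEquality A) where

  rle : List A → List (A × ℕ)
  rle [] = []
  rle (a ∷ s) with rle s
  ... | [] = (a , 1) ∷ []
  ... | (b , e) ∷ r = if does (a ≟ b) then (b , suc e) ∷ r else (a , 1) ∷ (b , e) ∷ r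

  -- S[i..j] with 0-indexed inclusive positions i ≤ j
  substr : List A → ℕ → ℕ → List A
  substr S i j = take (suc j ∸ i) (drop i S)

  occ : List A → List A → ℕ
  occ S X = length (filter (λ k → prefix? _≟_ X (drop k S)) (upTo (suc (length S))))

  IsPalindrome : List A → Set
  IsPalindrome X = X ≡ reverse X

  IsMUPS : List A → ℕ × ℕ → Set
  IsMUPS S (i , j) =
    i ≤ j × j < length S ×
    IsPalindrome (substr S i j) × occ S (substr S i j) ≡ 1 ×
    (suc j ∸ i ≤ 2 ⊎ (suc j ∸ i ≥ 3 × occ S (substr S (suc i) (j ∸ 1)) ≥ 2))

{-# OPTIONS --safe #-}
-- Send each MUPS S[i..j] to its doubled centre i + j. This map is injective: two MUPSs with
-- the same centre are nested, and the interior of a MUPS occurs twice in S, so a MUPS inside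
-- it would not be unique. Its values are doubled centres of runs of S: let S[s..t] be the
-- maximal run containing the middle position of the MUPS. If s + t < i + j, then either the
-- run ends inside the MUPS, and the mirror image of position t + 1 in the palindrome lies in
-- the run, contradicting maximality; or the run contains the MUPS together with its shift one
-- position to the left, contradicting uniqueness. The case s + t > i + j is symmetric.
module Submission where

open import Defs
open import Data.Nat
open import Data.Nat.Properties
open import Data.Nat.Properties using () renaming (_≟_ to _≟ℕ_)
open import Data.Nat.Tactic.RingSolver using (solve-∀)
open import Data.List using (List; []; _∷_; length; take; drop; reverse; upTo; filter; _++_; [_]; replicate; map)
open import Data.List.Properties using (unfold-reverse; length-reverse; length-take; length-drop; length-map; length-removeAt′)
open import Data.List.Relation.Binary.Prefix.Heterogeneous using (Prefix; []; _∷_)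
open import Data.List.Relation.Binary.Prefix.Heterogeneous.Properties using (prefix?)
open import Data.List.Relation.Unary.All using (All; []; _∷_)
import Data.List.Relation.Unary.All as All
import Data.List.Relation.Unary.All.Properties as All
open import Data.List.Relation.Unary.Any using (here; there)
open import Data.List.Relation.Unary.Unique.Propositional using (Unique; []; _∷_)
open import Data.List.Relation.Unary.Unique.Propositional.Properties using (upTo⁺; filter⁺)
open import Data.List.Membership.Propositional using (_∈_; _─_)
open import Data.List.Membership.Propositional.Properties using (∈-upTo⁺; ∈-filter⁺; ∈-filter⁻; ∈-map⁺)
open import Data.Maybe using (Maybe; just; nothing)
open import Data.Maybe.Properties using (just-injective)
open import Data.Product using (_×_; _,_; ∃-syntax; proj₁; proj₂)
open import Data.Sum using (_⊎_; inj₁; inj₂)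
open import Data.Unit using (⊤; tt)
open import Data.Empty using (⊥; ⊥-elim)
open import Relation.Nullary using (¬_; Dec; yes; no)
open import Relation.Binary.PropositionalEquality hiding ([_])
open import Relation.Binary.Definitions using (DecidableEquality; tri<; tri≈; tri>)

module _ {A : Set} where

  infixl 9 _‼_
  _‼_ : List A → ℕ → Maybe A
  []       ‼ _     = nothing
  (x ∷ xs) ‼ zero  = just x
  (x ∷ xs) ‼ suc d = xs ‼ d

  ‼-take : ∀ n (xs : List A) {d} → d < n → take n xs ‼ d ≡ xs ‼ d
  ‼-take (suc n) []       _                 = refl
  ‼-take (suc n) (x ∷ xs) {zero}  _         = refl
  ‼-take (suc n) (x ∷ xs) {suc d} (s<s d<n) = ‼-take n xs d<n

  ‼-drop : ∀ k (xs : List A) d → drop k xs ‼ d ≡ xs ‼ (k + d)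
  ‼-drop zero    xs       d = refl
  ‼-drop (suc k) []       d = refl
  ‼-drop (suc k) (x ∷ xs) d = ‼-drop k xs d

  ‼-++ˡ : ∀ (xs ys : List A) {d} → d < length xs → (xs ++ ys) ‼ d ≡ xs ‼ d
  ‼-++ˡ (x ∷ xs) ys {zero}  _         = refl
  ‼-++ˡ (x ∷ xs) ys {suc d} (s<s d<n) = ‼-++ˡ xs ys d<n

  ‼-++ʳ : ∀ (xs ys : List A) d → (xs ++ ys) ‼ (length xs + d) ≡ ys ‼ d
  ‼-++ʳ []       ys d = refl
  ‼-++ʳ (x ∷ xs) ys d = ‼-++ʳ xs ys d

  ‼-reverse : ∀ (xs : List A) {d e} → suc (d + e) ≡ length xs → reverse xs ‼ d ≡ xs ‼ e
  ‼-reverse (x ∷ xs) {d} {e} eq rewrite unfold-reverse x xs with e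
  ... | zero = begin
    (reverse xs ++ [ x ]) ‼ d                         ≡⟨ cong ((reverse xs ++ [ x ]) ‼_) d≡length ⟩
    (reverse xs ++ [ x ]) ‼ (length (reverse xs) + 0) ≡⟨ ‼-++ʳ (reverse xs) [ x ] 0 ⟩
    just x                                            ∎
    where
      open ≡-Reasoning
      d≡length : d ≡ length (reverse xs) + 0
      d≡length = trans (sym (+-identityʳ d))
        (trans (suc-injective eq) (trans (sym (length-reverse xs)) (sym (+-identityʳ _))))
  ... | suc e′ = begin
    (reverse xs ++ [ x ]) ‼ d ≡⟨ ‼-++ˡ (reverse xs) [ x ] d<length ⟩
    reverse xs ‼ d            ≡⟨ ‼-reverse xs (trans (sym (+-suc d e′)) (suc-injective eq)) ⟩
    xs ‼ e′                   ∎
    where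
      open ≡-Reasoning
      d<length : d < length (reverse xs)
      d<length = subst (d <_) (sym (length-reverse xs))
        (≤-trans (s≤s (m≤m+n d e′)) (≤-reflexive (trans (sym (+-suc d e′)) (suc-injective eq))))

  ‼-replicate-++ˡ : ∀ n (a : A) ys {d} → d < n → (replicate n a ++ ys) ‼ d ≡ just a
  ‼-replicate-++ˡ (suc n) a ys {zero}  _         = refl
  ‼-replicate-++ˡ (suc n) a ys {suc d} (s<s d<n) = ‼-replicate-++ˡ n a ys d<n

  ‼-replicate-++ʳ : ∀ n (a : A) ys d → (replicate n a ++ ys) ‼ (n + d) ≡ ys ‼ d
  ‼-replicate-++ʳ zero    a ys d = refl
  ‼-replicate-++ʳ (suc n) a ys d = ‼-replicate-++ʳ n a ys d

  length-replicate-++ : ∀ n {a : A} {ys} → length (replicate n a ++ ys) ≡ n + length ys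
  length-replicate-++ zero    = refl
  length-replicate-++ (suc n) = cong suc (length-replicate-++ n)

  ‼-just⇒< : ∀ (xs : List A) d {a} → xs ‼ d ≡ just a → d < length xs
  ‼-just⇒< (x ∷ xs) zero    _  = z<s
  ‼-just⇒< (x ∷ xs) (suc d) eq = s<s (‼-just⇒< xs d eq)

  <⇒‼-just : ∀ (xs : List A) {d} → d < length xs → ∃[ a ] xs ‼ d ≡ just a
  <⇒‼-just (x ∷ xs) {zero}  _         = x , refl
  <⇒‼-just (x ∷ xs) {suc d} (s<s d<n) = <⇒‼-just xs d<n

  Prefix⇒‼ : ∀ {X Y : List A} → Prefix _≡_ X Y → ∀ {d} → d < length X → X ‼ d ≡ Y ‼ d
  Prefix⇒‼ (refl ∷ p) {zero}  _         = refl
  Prefix⇒‼ (refl ∷ p) {suc d} (s<s d<n) = Prefix⇒‼ p d<n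

  ‼⇒Prefix : ∀ (X Y : List A) → (∀ {d} → d < length X → X ‼ d ≡ Y ‼ d) → Prefix _≡_ X Y
  ‼⇒Prefix []      Y       _  = []
  ‼⇒Prefix (x ∷ X) []      eq with () ← eq {0} z<s
  ‼⇒Prefix (x ∷ X) (y ∷ Y) eq with refl ← eq {0} z<s = refl ∷ ‼⇒Prefix X Y (λ d<n → eq (s<s d<n))

module _ {A : Set} where

  ∈-─⁺ : ∀ {x y : A} {ys} (x∈ys : x ∈ ys) → y ∈ ys → x ≢ y → y ∈ ys ─ x∈ys
  ∈-─⁺ (here refl)  (here refl)  x≢y = ⊥-elim (x≢y refl)
  ∈-─⁺ (here refl)  (there y∈ys) _   = y∈ys
  ∈-─⁺ (there _)    (here refl)  _   = here refl
  ∈-─⁺ (there x∈ys) (there y∈ys) x≢y = there (∈-─⁺ x∈ys y∈ys x≢y)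

  ∈∈≢⇒2≤length : ∀ {x y : A} {zs} → x ∈ zs → y ∈ zs → x ≢ y → 2 ≤ length zs
  ∈∈≢⇒2≤length (here refl) (here refl) x≢y = ⊥-elim (x≢y refl)
  ∈∈≢⇒2≤length {zs = _ ∷ _ ∷ _} (here _)  (there _) _ = s≤s (s≤s z≤n)
  ∈∈≢⇒2≤length {zs = _ ∷ _ ∷ _} (there _) _         _ = s≤s (s≤s z≤n)

  Unique-⊆⇒length≤ : ∀ {xs ys : List A} → Unique xs → All (_∈ ys) xs → length xs ≤ length ys
  Unique-⊆⇒length≤ [] [] = z≤n
  Unique-⊆⇒length≤ {x ∷ xs} {ys} (x∉xs ∷ u) (x∈ys ∷ xs⊆ys) = begin
    suc (length xs)          ≤⟨ s≤s (Unique-⊆⇒length≤ u (rest x∉xs xs⊆ys)) ⟩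
    suc (length (ys ─ x∈ys)) ≡⟨ sym (length-removeAt′ ys _) ⟩
    length ys                ∎
    where
      open ≤-Reasoning
      rest : ∀ {zs} → All (_ ≢_) zs → All (_∈ ys) zs → All (_∈ ys ─ x∈ys) zs
      rest []           []            = []
      rest (x≢z ∷ x≢zs) (z∈ys ∷ zs⊆ys) = ∈-─⁺ x∈ys z∈ys x≢z ∷ rest x≢zs zs⊆ys

  Unique-map⁺ : ∀ {B : Set} {P : A → Set} (f : A → B) →
    (∀ {x y} → P x → P y → f x ≡ f y → x ≡ y) →
    ∀ {xs} → All P xs → Unique xs → Unique (map f xs)
  Unique-map⁺           f inj []         []       = []
  Unique-map⁺ {P = P} f inj (px ∷ pxs) (x∉ ∷ u) = distinct pxs x∉ ∷ Unique-map⁺ f inj pxs u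
    where
      distinct : ∀ {ys} → All P ys → All (_ ≢_) ys → All (f _ ≢_) (map f ys)
      distinct []         []           = []
      distinct (py ∷ pys) (x≢y ∷ x≢ys) = (λ eq → x≢y (inj px py eq)) ∷ distinct pys x≢ys

Unique∧2≤length⇒∃≢ : ∀ {zs : List ℕ} → Unique zs → 2 ≤ length zs → ∀ z → ∃[ x ] x ∈ zs × x ≢ z
Unique∧2≤length⇒∃≢ {x ∷ y ∷ _} ((x≢y ∷ _) ∷ _) _ z with x ≟ z
... | yes refl = y , there (here refl) , λ y≡x → x≢y (sym y≡x)
... | no  x≢z  = x , here refl , x≢z
Unique∧2≤length⇒∃≢ {_ ∷ []} _ (s≤s ())

module _ {A : Set} where

  SameFactor : List A → ℕ → ℕ → ℕ → Set
  SameFactor S L i k = ∀ {d} → d < L → S ‼ (i + d) ≡ S ‼ (k + d)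

  SameFactor-infix : ∀ {S L L′ i k} a → a + L′ ≤ L → SameFactor S L i k → SameFactor S L′ (i + a) (k + a)
  SameFactor-infix {S} {i = i} {k} a a+L′≤L same {d} d<L′ = begin
    S ‼ (i + a + d)   ≡⟨ cong (S ‼_) (+-assoc i a d) ⟩
    S ‼ (i + (a + d)) ≡⟨ same (<-≤-trans (+-monoʳ-< a d<L′) a+L′≤L) ⟩
    S ‼ (k + (a + d)) ≡⟨ cong (S ‼_) (sym (+-assoc k a d)) ⟩
    S ‼ (k + a + d)   ∎
    where open ≡-Reasoning

  SameFactor⇒< : ∀ S {L i k} → i < length S → SameFactor S (suc L) i k → k < length S
  SameFactor⇒< S {i = i} {k} i<n same with a , S‼i≡a ← <⇒‼-just S i<n =
    subst (_< length S) (+-identityʳ k)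
      (‼-just⇒< S (k + 0) (trans (sym (same z<s)) (trans (cong (S ‼_) (+-identityʳ i)) S‼i≡a)))

module _ {A : Set} (_≟_ : DecidableEquality A) (S : List A) where

  private
    occurs? : ∀ X k → Dec (Prefix _≡_ X (drop k S))
    occurs? X k = prefix? _≟_ X (drop k S)

    ∈-occurrences : ∀ {X k} → k ≤ length S → Prefix _≡_ X (drop k S) →
      k ∈ filter (occurs? X) (upTo (suc (length S)))
    ∈-occurrences {X} k≤n occurs = ∈-filter⁺ (occurs? X) (∈-upTo⁺ (s≤s k≤n)) occurs

  occurrences≢⇒2≤occ : ∀ {X k k′} → k ≢ k′ → k ≤ length S → k′ ≤ length S →
    Prefix _≡_ X (drop k S) → Prefix _≡_ X (drop k′ S) → 2 ≤ occ _≟_ S X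
  occurrences≢⇒2≤occ k≢k′ k≤n k′≤n occurs occurs′ =
    ∈∈≢⇒2≤length (∈-occurrences k≤n occurs) (∈-occurrences k′≤n occurs′) k≢k′

  2≤occ⇒occurrence≢ : ∀ {X} → 2 ≤ occ _≟_ S X → ∀ z → ∃[ k ] k ≢ z × Prefix _≡_ X (drop k S)
  2≤occ⇒occurrence≢ {X} 2≤occ z
    with k , k∈ , k≢z ← Unique∧2≤length⇒∃≢ (filter⁺ (occurs? X) (upTo⁺ (suc (length S)))) 2≤occ z =
    k , k≢z , proj₂ (∈-filter⁻ (occurs? X) k∈)

  length-substr : ∀ i {j} → j < length S → length (substr _≟_ S i j) ≡ suc j ∸ i
  length-substr i {j} j<n = begin
    length (take (suc j ∸ i) (drop i S)) ≡⟨ length-take (suc j ∸ i) (drop i S) ⟩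
    (suc j ∸ i) ⊓ length (drop i S)      ≡⟨ cong ((suc j ∸ i) ⊓_) (length-drop i S) ⟩
    (suc j ∸ i) ⊓ (length S ∸ i)         ≡⟨ m≤n⇒m⊓n≡m (∸-monoˡ-≤ i j<n) ⟩
    suc j ∸ i                            ∎
    where open ≡-Reasoning

  substr-‼ : ∀ i j {d} → d < suc j ∸ i → substr _≟_ S i j ‼ d ≡ S ‼ (i + d)
  substr-‼ i j {d} d<L = trans (‼-take (suc j ∸ i) (drop i S) d<L) (‼-drop i S d)

  Prefix-substr⇒SameFactor : ∀ i {j k} → j < length S →
    Prefix _≡_ (substr _≟_ S i j) (drop k S) → SameFactor S (suc j ∸ i) i k
  Prefix-substr⇒SameFactor i {j} {k} j<n occurs {d} d<L = begin
    S ‼ (i + d)               ≡⟨ substr-‼ i j d<L ⟨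
    substr _≟_ S i j ‼ d      ≡⟨ Prefix⇒‼ occurs (subst (d <_) (sym (length-substr i j<n)) d<L) ⟩
    drop k S ‼ d              ≡⟨ ‼-drop k S d ⟩
    S ‼ (k + d)               ∎
    where open ≡-Reasoning

  SameFactor⇒Prefix-substr : ∀ i {j k} → j < length S →
    SameFactor S (suc j ∸ i) i k → Prefix _≡_ (substr _≟_ S i j) (drop k S)
  SameFactor⇒Prefix-substr i {j} {k} j<n same = ‼⇒Prefix _ _ λ {d} d<length →
    let d<L = subst (d <_) (length-substr i j<n) d<length in begin
    substr _≟_ S i j ‼ d      ≡⟨ substr-‼ i j d<L ⟩
    S ‼ (i + d)               ≡⟨ same d<L ⟩
    S ‼ (k + d)               ≡⟨ ‼-drop k S d ⟨
    drop k S ‼ d              ∎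
    where open ≡-Reasoning

record MUPSAt {A : Set} (S : List A) (i l : ℕ) : Set where
  field
    inBounds         : i + l < length S
    mirror           : ∀ {x y} → i ≤ x → i ≤ y → x + y ≡ i + (i + l) → S ‼ x ≡ S ‼ y
    unique           : ∀ {k} → SameFactor S (suc l) i k → k ≡ i
    interior-repeats : 2 ≤ l → ∃[ k ] k ≢ suc i × SameFactor S (l ∸ 1) (suc i) k

suc[i+l]∸i≡suc[l] : ∀ i l → suc (i + l) ∸ i ≡ suc l
suc[i+l]∸i≡suc[l] i l = trans (cong (_∸ i) (sym (+-suc i l))) (m+n∸m≡n i (suc l))

module _ {A : Set} (_≟_ : DecidableEquality A) (S : List A) {i l} (i+l<n : i + l < length S) where

  private
    window = substr _≟_ S i (i + l)

    length-window : length window ≡ suc l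
    length-window = trans (length-substr _≟_ S i i+l<n) (suc[i+l]∸i≡suc[l] i l)

    window-‼ : ∀ {d} → d ≤ l → window ‼ d ≡ S ‼ (i + d)
    window-‼ {d} d≤l = substr-‼ _≟_ S i (i + l) (subst (d <_) (sym (suc[i+l]∸i≡suc[l] i l)) (s≤s d≤l))

    occurs-at : ∀ {k} → SameFactor S (suc l) i k → Prefix _≡_ window (drop k S)
    occurs-at {k} same = SameFactor⇒Prefix-substr _≟_ S i i+l<n
      (subst (λ L → SameFactor S L i k) (sym (suc[i+l]∸i≡suc[l] i l)) same)

    [i+d]+[i+e]≡i+[i+[d+e]] : ∀ i d e → (i + d) + (i + e) ≡ i + (i + (d + e))
    [i+d]+[i+e]≡i+[i+[d+e]] = solve-∀

  palindrome⇒mirror : IsPalindrome _≟_ window →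
    ∀ {x y} → i ≤ x → i ≤ y → x + y ≡ i + (i + l) → S ‼ x ≡ S ‼ y
  palindrome⇒mirror palindrome i≤x i≤y x+y≡c
    with d , refl ← m≤n⇒∃[o]m+o≡n i≤x | e , refl ← m≤n⇒∃[o]m+o≡n i≤y = begin
      S ‼ (i + d)        ≡⟨ window-‼ (subst (d ≤_) d+e≡l (m≤m+n d e)) ⟨
      window ‼ d         ≡⟨ cong (_‼ d) palindrome ⟩
      reverse window ‼ d ≡⟨ ‼-reverse window (trans (cong suc d+e≡l) (sym length-window)) ⟩
      window ‼ e         ≡⟨ window-‼ (subst (e ≤_) d+e≡l (m≤n+m e d)) ⟩
      S ‼ (i + e)        ∎
    where
      open ≡-Reasoning
      d+e≡l : d + e ≡ l
      d+e≡l = +-cancelˡ-≡ i _ _ (+-cancelˡ-≡ i _ _ (trans (sym ([i+d]+[i+e]≡i+[i+[d+e]] i d e)) x+y≡c))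

  occ≡1⇒unique : occ _≟_ S window ≡ 1 → ∀ {k} → SameFactor S (suc l) i k → k ≡ i
  occ≡1⇒unique occ≡1 {k} same with k ≟ℕ i
  ... | yes k≡i = k≡i
  ... | no  k≢i = ⊥-elim (<-irrefl (sym occ≡1)
    (occurrences≢⇒2≤occ _≟_ S k≢i
      (<⇒≤ (SameFactor⇒< S i<n same)) (<⇒≤ i<n) (occurs-at same) (occurs-at {i} (λ _ → refl))))
    where
      i<n : i < length S
      i<n = ≤-<-trans (m≤m+n i l) i+l<n

  2≤occ⇒interior-repeats : 2 ≤ occ _≟_ S (substr _≟_ S (suc i) (i + l ∸ 1)) →
    2 ≤ l → ∃[ k ] k ≢ suc i × SameFactor S (l ∸ 1) (suc i) k
  2≤occ⇒interior-repeats 2≤occ (s≤s (s≤s {n = n} _))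
    with k , k≢ , occurs ← 2≤occ⇒occurrence≢ _≟_ S 2≤occ (suc i) =
    k , k≢ , subst (λ L → SameFactor S L (suc i) k) interior-length
               (Prefix-substr⇒SameFactor _≟_ S (suc i) (≤-<-trans (m∸n≤m _ 1) i+l<n) occurs)
    where
      interior-length : i + suc (suc n) ∸ 1 ∸ i ≡ suc n
      interior-length = trans (cong (λ m → m ∸ 1 ∸ i) (+-suc i (suc n))) (m+n∸m≡n i (suc n))

IsMUPS⇒MUPSAt : ∀ {A : Set} (_≟_ : DecidableEquality A) (S : List A) {i l} →
  IsMUPS _≟_ S (i , i + l) → MUPSAt S i l
IsMUPS⇒MUPSAt _≟_ S {i} {l} (_ , i+l<n , palindrome , occ≡1 , minimal) = record
  { inBounds         = i+l<n
  ; mirror           = palindrome⇒mirror _≟_ S i+l<n palindrome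
  ; unique           = occ≡1⇒unique _≟_ S i+l<n occ≡1
  ; interior-repeats = λ 2≤l → 2≤occ⇒interior-repeats _≟_ S i+l<n (interior-occ minimal 2≤l) 2≤l
  }
  where
    interior-occ : suc (i + l) ∸ i ≤ 2
                     ⊎ (suc (i + l) ∸ i ≥ 3 × occ _≟_ S (substr _≟_ S (suc i) (i + l ∸ 1)) ≥ 2) →
      2 ≤ l → 2 ≤ occ _≟_ S (substr _≟_ S (suc i) (i + l ∸ 1))
    interior-occ (inj₁ short)       2≤l =
      ⊥-elim (<⇒≱ (s≤s 2≤l) (subst (_≤ 2) (suc[i+l]∸i≡suc[l] i l) short))
    interior-occ (inj₂ (_ , 2≤occ)) _   = 2≤occ

module _ {A : Set} {S : List A} where

  MUPSAt-∉-interior : ∀ {i n l′} a → a + suc l′ ≤ suc n →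
    MUPSAt S i (suc (suc n)) → MUPSAt S (suc i + a) l′ → ⊥
  MUPSAt-∉-interior {i} a fits outer inner
    with k , k≢suc[i] , same ← MUPSAt.interior-repeats outer (s≤s (s≤s z≤n)) =
    k≢suc[i] (+-cancelʳ-≡ a k (suc i) (MUPSAt.unique inner (SameFactor-infix {S = S} {i = suc i} {k} a fits same)))

  MUPSAt-same-centre⇒≮ : ∀ {i l i′ l′} → MUPSAt S i l → MUPSAt S i′ l′ →
    i + (i + l) ≡ i′ + (i′ + l′) → ¬ i < i′
  MUPSAt-same-centre⇒≮ {i} {l} {_} {l′} m m′ same-centre i<i′ with a , refl ← m≤n⇒∃[o]m+o≡n i<i′ =
    MUPSAt-∉-interior a fits (subst (MUPSAt S i) l≡ m) m′
    where
      shift : ∀ i a l′ → suc i + a + (suc i + a + l′) ≡ i + (i + suc (suc (a + a + l′)))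
      shift = solve-∀
      l≡ : l ≡ suc (suc (a + a + l′))
      l≡ = +-cancelˡ-≡ i _ _ (+-cancelˡ-≡ i _ _ (trans same-centre (shift i a l′)))
      fits : a + suc l′ ≤ suc (a + a + l′)
      fits = subst (_≤ suc (a + a + l′)) (sym (+-suc a l′)) (s≤s (+-monoˡ-≤ l′ (m≤n+m a a)))

  MUPSAt-centre-injective : ∀ {i l i′ l′} → MUPSAt S i l → MUPSAt S i′ l′ →
    i + (i + l) ≡ i′ + (i′ + l′) → i ≡ i′
  MUPSAt-centre-injective {i} {_} {i′} m m′ same-centre with <-cmp i i′
  ... | tri< i<i′ _ _ = ⊥-elim (MUPSAt-same-centre⇒≮ m m′ same-centre i<i′)
  ... | tri≈ _ i≡i′ _ = i≡i′
  ... | tri> _ _ i′<i = ⊥-elim (MUPSAt-same-centre⇒≮ m′ m (sym same-centre) i′<i)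

record MaximalRun {A : Set} (T : List A) (s t : ℕ) : Set where
  field
    constant      : ∀ {x} → s ≤ x → x ≤ t → T ‼ x ≡ T ‼ s
    left-maximal  : ∀ {s₀} → s ≡ suc s₀ → T ‼ s₀ ≢ T ‼ s
    right-maximal : T ‼ suc t ≢ T ‼ t

  same-letter : ∀ {x y} → s ≤ x → x ≤ t → s ≤ y → y ≤ t → T ‼ x ≡ T ‼ y
  same-letter s≤x x≤t s≤y y≤t = trans (constant s≤x x≤t) (sym (constant s≤y y≤t))

module _ {A : Set} {S : List A} where

  MUPSAt-in-run⇒unique : ∀ {i l s t k} → MUPSAt S i l → MaximalRun S s t →
    s ≤ i → i + l ≤ t → s ≤ k → k + l ≤ t → k ≡ i
  MUPSAt-in-run⇒unique {i} {l} {k = k} m run s≤i i+l≤t s≤k k+l≤t =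
    MUPSAt.unique m λ {d} d<suc[l] → let d≤l = s≤s⁻¹ d<suc[l] in
      MaximalRun.same-letter run (≤-trans s≤i (m≤m+n i d)) (≤-trans (+-monoʳ-≤ i d≤l) i+l≤t)
                                 (≤-trans s≤k (m≤m+n k d)) (≤-trans (+-monoʳ-≤ k d≤l) k+l≤t)

  run-centre≮MUPS-centre : ∀ {i l s t p} → MUPSAt S i l → MaximalRun S s t →
    i ≤ p → p ≤ t → i + (i + l) ≤ suc (p + p) → ¬ s + t < i + (i + l)
  run-centre≮MUPS-centre {i} {l} {s} {t} {p} m run i≤p p≤t c≤1+2p s+t<c with t <? i + l
  ... | no t≮i+l
    with w , refl ← m≤n⇒∃[o]m+o≡n (+-cancelʳ-< t s i (<-≤-trans s+t<c (+-monoʳ-≤ i (≮⇒≥ t≮i+l)))) =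
    1+n≢n (sym (MUPSAt-in-run⇒unique m run (≤-trans (m≤m+n s w) (n≤1+n _)) i+l≤t
                                          (m≤m+n s w) (≤-trans (+-monoˡ-≤ l (n≤1+n _)) i+l≤t)))
    where
      i+l≤t = ≮⇒≥ t≮i+l
  ... | yes t<i+l with y , t+1+y≡c ← m≤n⇒∃[o]m+o≡n (≤-trans (s≤s (m≤n+m t s)) s+t<c) =
    MaximalRun.right-maximal run
      (trans (MUPSAt.mirror m (≤-trans (≤-trans i≤p p≤t) (n≤1+n t)) i≤y t+1+y≡c)
             (MaximalRun.same-letter run s≤y y≤t (≤-trans s≤y y≤t) ≤-refl))
    where
      open ≤-Reasoning
      i≤y : i ≤ y
      i≤y = +-cancelˡ-≤ (i + l) i y (begin
        (i + l) + i ≡⟨ +-comm (i + l) i ⟩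
        i + (i + l) ≡⟨ t+1+y≡c ⟨
        suc t + y   ≤⟨ +-monoˡ-≤ y t<i+l ⟩
        (i + l) + y ∎)
      s≤y : s ≤ y
      s≤y = +-cancelʳ-≤ (suc t) s y (begin
        s + suc t   ≡⟨ +-suc s t ⟩
        suc (s + t) ≤⟨ s+t<c ⟩
        i + (i + l) ≡⟨ t+1+y≡c ⟨
        suc t + y   ≡⟨ +-comm (suc t) y ⟩
        y + suc t   ∎)
      y≤t : y ≤ t
      y≤t = +-cancelˡ-≤ (suc t) y t (begin
        suc t + y   ≡⟨ t+1+y≡c ⟩
        i + (i + l) ≤⟨ c≤1+2p ⟩
        suc (p + p) ≤⟨ s≤s (+-mono-≤ p≤t p≤t) ⟩
        suc t + t   ∎)

  MUPS-centre≮run-centre : ∀ {i l s t p} → MUPSAt S i l → MaximalRun S s t →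
    s ≤ p → p + p ≤ i + (i + l) → ¬ i + (i + l) < s + t
  MUPS-centre≮run-centre {i} {l} {s} {t} {p} m run s≤p 2p≤c c<s+t with i <? s
  ... | no i≮s = 1+n≢n (MUPSAt-in-run⇒unique m run s≤i (<⇒≤ i+l<t) (≤-trans s≤i (n≤1+n i)) i+l<t)
    where
      s≤i = ≮⇒≥ i≮s
      i+l<t : i + l < t
      i+l<t = +-cancelˡ-< i (i + l) t (<-≤-trans c<s+t (+-monoˡ-≤ t s≤i))
  ... | yes i<s with m≤n⇒∃[o]m+o≡n i<s
  ... | w , refl
    with y , s₀+y≡c ← m≤n⇒∃[o]m+o≡n (≤-trans (n≤1+n (i + w)) (≤-trans s≤p (≤-trans (m≤m+n p p) 2p≤c))) =
    MaximalRun.left-maximal run refl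
      (trans (MUPSAt.mirror m (m≤m+n i w) (≤-trans (n≤1+n i) (≤-trans (s≤s (m≤m+n i w)) s≤y)) s₀+y≡c)
             (MaximalRun.same-letter run s≤y y≤t ≤-refl (≤-trans s≤y y≤t)))
    where
      open ≤-Reasoning
      s₀ = i + w
      s≤y : suc s₀ ≤ y
      s≤y = +-cancelˡ-≤ s₀ (suc s₀) y (begin
        s₀ + suc s₀     ≤⟨ +-monoˡ-≤ (suc s₀) (n≤1+n s₀) ⟩
        suc s₀ + suc s₀ ≤⟨ +-mono-≤ s≤p s≤p ⟩
        p + p           ≤⟨ 2p≤c ⟩
        i + (i + l)     ≡⟨ s₀+y≡c ⟨
        s₀ + y          ∎)
      y≤t : y ≤ t
      y≤t = +-cancelˡ-≤ s₀ y t (s≤s⁻¹ (begin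
        suc (s₀ + y)      ≡⟨ cong suc s₀+y≡c ⟩
        suc (i + (i + l)) ≤⟨ c<s+t ⟩
        suc s₀ + t        ∎))

  run-centre≡MUPS-centre : ∀ {i l s t p} → MUPSAt S i l → MaximalRun S s t →
    s ≤ p → p ≤ t → i ≤ p → p + p ≤ i + (i + l) → i + (i + l) ≤ suc (p + p) → s + t ≡ i + (i + l)
  run-centre≡MUPS-centre m run s≤p p≤t i≤p 2p≤c c≤1+2p =
    ≤-antisym (≮⇒≥ (MUPS-centre≮run-centre m run s≤p 2p≤c))
              (≮⇒≥ (run-centre≮MUPS-centre m run i≤p p≤t c≤1+2p))

module _ {A : Set} where

  expand : List (A × ℕ) → List A
  expand []            = []
  expand ((a , e) ∷ r) = replicate e a ++ expand r

  WellFormed : List (A × ℕ) → Set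
  WellFormed []            = ⊤
  WellFormed ((a , e) ∷ r) = 1 ≤ e × expand r ‼ 0 ≢ just a × WellFormed r

  -- Run centres are doubled (s + t for the run T[s..t]) so that they are natural numbers.
  runCentres : List (A × ℕ) → List ℕ
  runCentres []            = []
  runCentres ((a , e) ∷ r) = pred e ∷ map (λ c → e + (e + c)) (runCentres r)

  length-runCentres : ∀ r → length (runCentres r) ≡ length r
  length-runCentres []      = refl
  length-runCentres (_ ∷ r) = cong suc (trans (length-map _ (runCentres r)) (length-runCentres r))

  module _ (_≟_ : DecidableEquality A) where

    expand-rle : ∀ s → expand (rle _≟_ s) ≡ s
    expand-rle []      = refl
    expand-rle (a ∷ s) with rle _≟_ s | expand-rle s
    ... | []          | refl = refl
    ... | (b , e) ∷ r | refl with a ≟ b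
    ...   | yes refl = refl
    ...   | no  _    = refl

    rle-wellFormed : ∀ s → WellFormed (rle _≟_ s)
    rle-wellFormed []      = tt
    rle-wellFormed (a ∷ s) with rle _≟_ s | rle-wellFormed s
    ... | []                | _ = s≤s z≤n , (λ ()) , tt
    ... | (b , suc e) ∷ r   | wf@(_ , b≢r , _) with a ≟ b
    ...   | yes refl = s≤s z≤n , b≢r , proj₂ (proj₂ wf)
    ...   | no  a≢b  = s≤s z≤n , (λ b≡a → a≢b (sym (just-injective b≡a))) , wf

  maximalRun-head : ∀ {a e} {T : List A} → T ‼ 0 ≢ just a → MaximalRun (replicate (suc e) a ++ T) 0 e
  maximalRun-head {a} {e} {T} T≢a = record
    { constant      = λ {x} _ x≤e → ‼-replicate-++ˡ (suc e) a T (s≤s x≤e)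
    ; left-maximal  = λ ()
    ; right-maximal = λ next≡a → T≢a (begin
        T ‼ 0           ≡⟨ ‼-replicate-++ʳ (suc e) a T 0 ⟨
        U ‼ (suc e + 0) ≡⟨ cong (U ‼_) (+-identityʳ (suc e)) ⟩
        U ‼ suc e       ≡⟨ next≡a ⟩
        U ‼ e           ≡⟨ ‼-replicate-++ˡ (suc e) a T ≤-refl ⟩
        just a          ∎)
    }
    where
      open ≡-Reasoning
      U = replicate (suc e) a ++ T

  maximalRun-shift : ∀ {a n s t} {T : List A} → T ‼ 0 ≢ just a → MaximalRun T s t →
    MaximalRun (replicate n a ++ T) (n + s) (n + t)
  maximalRun-shift {a} {n} {s} {t} {T} T≢a run = record
    { constant      = constant
    ; left-maximal  = left-maximal s run
    ; right-maximal = λ eq → MaximalRun.right-maximal run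
        (trans (sym (shifted (suc t))) (trans (cong (U ‼_) (+-suc n t)) (trans eq (shifted t))))
    }
    where
      U = replicate n a ++ T

      shifted : ∀ d → U ‼ (n + d) ≡ T ‼ d
      shifted = ‼-replicate-++ʳ n a T

      constant : ∀ {x} → n + s ≤ x → x ≤ n + t → U ‼ x ≡ U ‼ (n + s)
      constant n+s≤x x≤n+t with y , refl ← m≤n⇒∃[o]m+o≡n (≤-trans (m≤m+n n s) n+s≤x) =
        trans (shifted y) (trans (MaximalRun.constant run (+-cancelˡ-≤ n s y n+s≤x) (+-cancelˡ-≤ n y t x≤n+t))
                                 (sym (shifted s)))

      left-maximal : ∀ s → MaximalRun T s t → ∀ {s₀} → n + s ≡ suc s₀ → U ‼ s₀ ≢ U ‼ (n + s)
      left-maximal zero _ {s₀} n+0≡1+s₀ eq = T≢a (begin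
        T ‼ 0       ≡⟨ shifted 0 ⟨
        U ‼ (n + 0) ≡⟨ eq ⟨
        U ‼ s₀      ≡⟨ ‼-replicate-++ˡ n a T (≤-reflexive (trans (sym n+0≡1+s₀) (+-identityʳ n))) ⟩
        just a      ∎)
        where open ≡-Reasoning
      left-maximal (suc s′) run′ n+1+s′≡1+s₀ eq
        with refl ← suc-injective (trans (sym (+-suc n s′)) n+1+s′≡1+s₀) =
        MaximalRun.left-maximal run′ refl (trans (sym (shifted s′)) (trans eq (shifted (suc s′))))

  maximalRun-containing : ∀ r → WellFormed r → ∀ {p} → p < length (expand r) →
    ∃[ s ] ∃[ t ] s ≤ p × p ≤ t × MaximalRun (expand r) s t × s + t ∈ runCentres r
  maximalRun-containing ((a , suc e) ∷ r) (_ , r≢a , wf) {p} p<n with p ≤? e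
  ... | yes p≤e = 0 , e , z≤n , p≤e , maximalRun-head r≢a , here refl
  ... | no  p≰e with m≤n⇒∃[o]m+o≡n (≰⇒> p≰e)
  ... | q , refl
    with maximalRun-containing r wf (+-cancelˡ-< (suc e) q _ (subst (suc e + q <_) (length-replicate-++ (suc e)) p<n))
  ... | s , t , s≤q , q≤t , run , s+t∈ =
    suc e + s , suc e + t , +-monoʳ-≤ (suc e) s≤q , +-monoʳ-≤ (suc e) q≤t , maximalRun-shift r≢a run ,
    there (subst (_∈ map shift (runCentres r)) (shift-sum (suc e) s t) (∈-map⁺ shift s+t∈))
    where
      shift : ℕ → ℕ
      shift c = suc e + (suc e + c)
      shift-sum : ∀ n s t → n + (n + (s + t)) ≡ (n + s) + (n + t)
      shift-sum = solve-∀

⌊n/2⌋+⌊n/2⌋≤n : ∀ n → ⌊ n /2⌋ + ⌊ n /2⌋ ≤ n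
⌊n/2⌋+⌊n/2⌋≤n zero          = z≤n
⌊n/2⌋+⌊n/2⌋≤n (suc zero)    = z≤n
⌊n/2⌋+⌊n/2⌋≤n (suc (suc n)) =
  s≤s (subst (_≤ suc n) (sym (+-suc ⌊ n /2⌋ ⌊ n /2⌋)) (s≤s (⌊n/2⌋+⌊n/2⌋≤n n)))

n≤1+⌊n/2⌋+⌊n/2⌋ : ∀ n → n ≤ suc (⌊ n /2⌋ + ⌊ n /2⌋)
n≤1+⌊n/2⌋+⌊n/2⌋ zero          = z≤n
n≤1+⌊n/2⌋+⌊n/2⌋ (suc zero)    = ≤-refl
n≤1+⌊n/2⌋+⌊n/2⌋ (suc (suc n)) =
  s≤s (subst (suc n ≤_) (cong suc (sym (+-suc ⌊ n /2⌋ ⌊ n /2⌋))) (s≤s (n≤1+⌊n/2⌋+⌊n/2⌋ n)))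

centre : ℕ × ℕ → ℕ
centre (i , j) = i + j

module _ {A : Set} (_≟_ : DecidableEquality A) (S : List A) where

  private
    IsMUPS⇒∃MUPSAt : ∀ {i j} → IsMUPS _≟_ S (i , j) → ∃[ l ] j ≡ i + l × MUPSAt S i l
    IsMUPS⇒∃MUPSAt mups with l , refl ← m≤n⇒∃[o]m+o≡n (proj₁ mups) = l , refl , IsMUPS⇒MUPSAt _≟_ S mups

  MUPS-centre-injective : ∀ {i j i′ j′} → IsMUPS _≟_ S (i , j) → IsMUPS _≟_ S (i′ , j′) →
    centre (i , j) ≡ centre (i′ , j′) → (i , j) ≡ (i′ , j′)
  MUPS-centre-injective {i} mups mups′ same-centre
    with _ , refl , m ← IsMUPS⇒∃MUPSAt mups | _ , refl , m′ ← IsMUPS⇒∃MUPSAt mups′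
    with refl ← MUPSAt-centre-injective m m′ same-centre = cong (i ,_) (+-cancelˡ-≡ i _ _ same-centre)

  MUPSAt-centre∈runCentres : ∀ {i l} → MUPSAt S i l → i + (i + l) ∈ runCentres (rle _≟_ S)
  MUPSAt-centre∈runCentres {i} {l} m = centre∈ (maximalRun-containing (rle _≟_ S) (rle-wellFormed _≟_ S) p<n)
    where
      c = i + (i + l)
      p = ⌊ c /2⌋

      i≤p : i ≤ p
      i≤p = ≤-trans (≤-reflexive (n≡⌊n+n/2⌋ i)) (⌊n/2⌋-mono (+-monoʳ-≤ i (m≤m+n i l)))

      p<n : p < length (expand (rle _≟_ S))
      p<n = begin-strict
        p                           ≤⟨ ⌊n/2⌋-mono (+-monoˡ-≤ (i + l) (m≤m+n i l)) ⟩
        ⌊ (i + l) + (i + l) /2⌋     ≡⟨ n≡⌊n+n/2⌋ (i + l) ⟨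
        i + l                       <⟨ MUPSAt.inBounds m ⟩
        length S                    ≡⟨ cong length (expand-rle _≟_ S) ⟨
        length (expand (rle _≟_ S)) ∎
        where open ≤-Reasoning

      centre∈ : ∃[ s ] ∃[ t ] s ≤ p × p ≤ t × MaximalRun (expand (rle _≟_ S)) s t ×
                                             s + t ∈ runCentres (rle _≟_ S) →
                c ∈ runCentres (rle _≟_ S)
      centre∈ (s , t , s≤p , p≤t , run , s+t∈) = subst (_∈ runCentres (rle _≟_ S))
        (run-centre≡MUPS-centre m (subst (λ T → MaximalRun T s t) (expand-rle _≟_ S) run)
           s≤p p≤t i≤p (⌊n/2⌋+⌊n/2⌋≤n c) (n≤1+⌊n/2⌋+⌊n/2⌋ c))
        s+t∈

  MUPS-centre∈runCentres : ∀ {i j} → IsMUPS _≟_ S (i , j) → centre (i , j) ∈ runCentres (rle _≟_ S)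
  MUPS-centre∈runCentres mups with _ , refl , m ← IsMUPS⇒∃MUPSAt mups = MUPSAt-centre∈runCentres m

corollary1 : {A : Set} (_≟_ : DecidableEquality A) (S : List A) →
    0 < length S →
    (M : List (ℕ × ℕ)) → Unique M → All (IsMUPS _≟_ S) M →
    length M ≤ length (rle _≟_ S)
corollary1 _≟_ S _ M unique mups = begin
  length M                        ≡⟨ length-map centre M ⟨
  length (map centre M)           ≤⟨ Unique-⊆⇒length≤ (Unique-map⁺ centre (MUPS-centre-injective _≟_ S) mups unique)
                                                      (All.map⁺ (All.map (MUPS-centre∈runCentres _≟_ S) mups)) ⟩
  length (runCentres (rle _≟_ S)) ≡⟨ length-runCentres (rle _≟_ S) ⟩
  length (rle _≟_ S)              ∎
  where open ≤-Reasoning
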